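{- Fix an integer $\delta \geq 2$. For $n$ divisible by $\delta+1$, let $G_1$ be the graph obtained from the disjoint union of $\frac{n}{\delta+1}$ copies of the complete graph $K_{\delta+1}$ by choosing one specified vertex in each copy and adding the edges of a star on the set of specified vertices (i.e., one specified vertex is joined to every other specified vertex). Then for all sufficiently large $n$ (depending on $\delta$) with $(\delta+1)\mid n$, and all sufficiently large $q$ (depending on $n$ and $\delta$), \[\hom(K_{\delta,n-\delta},K_q) < \hom(G_1,K_q).\]
   Context: For graphs $G$ and $H$, an $H$-coloring of $G$ is a map $f:V(G)\to V(H)$ such that $f(v)\sim_H f(w)$ whenever $v\sim_G w$, and $\hom(G,H)$ is the number of $H$-colorings of $G$. $K_q$ is the complete graph on $q$ vertices without loops (so $\hom(G,K_q)$ is the number of proper $q$-colorings of $G$), and $K_{a,b}$ is the complete bipartite graph with parts of sizes $a$ and $b$. Note that $G_1$ is a connected $n$-vertex graph with minimum degree $\delta$. -}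

module Defs where

open import Data.Bool using (Bool; true; false; _∧_; _∨_; not)
open import Data.Nat using (ℕ; zero; suc; _+_; _*_; _<ᵇ_; _≡ᵇ_)
open import Data.Nat.DivMod using (_/_; _%_)
open import Data.Fin using (Fin; toℕ)
open import Data.List using (List; []; _∷_; map; concatMap; length; filter; allFin)
open import Data.Bool.ListAction using (and)
open import Relation.Binary.PropositionalEquality using (_≡_)
open import Relation.Nullary using (Dec; yes; no)
open import Data.Bool using (T)
open import Relation.Nullary.Decidable using (T?)

-- A finite graph on vertex set Fin size, given by a (Boolean) adjacency
-- relation.  All graphs constructed below are visibly symmetric and loopless.
record Graph : Set where
  field
    size  : ℕ
    adj   : Fin size → Fin size → Bool
open Graph public

allMaps : (n m : ℕ) → List (Fin n → Fin m)
allMaps zero    m = (λ ()) ∷ []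
allMaps (suc n) m =
  concatMap (λ (f : Fin n → Fin m) →
    map (λ (c : Fin m) → extend c f) (allFin m)) (allMaps n m)
  where
  extend : {m : ℕ} → Fin m → (Fin n → Fin m) → Fin (suc n) → Fin m
  extend c f Fin.zero    = c
  extend c f (Fin.suc i) = f i

allᵇ : {A : Set} → (A → Bool) → List A → Bool
allᵇ p xs = and (map p xs)

isHomᵇ : (G H : Graph) → (Fin (size G) → Fin (size H)) → Bool
isHomᵇ G H f =
  allᵇ (λ u → allᵇ (λ v → not (adj G u v) ∨ adj H (f u) (f v))
                 (allFin (size G)))
      (allFin (size G))

hom : Graph → Graph → ℕ
hom G H = length (filter (λ f → T? (isHomᵇ G H f)) (allMaps (size G) (size H)))

neqᵇ : ℕ → ℕ → Bool
neqᵇ a b = not (a ≡ᵇ b)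

K : ℕ → Graph
K q = record { size = q ; adj = λ u v → neqᵇ (toℕ u) (toℕ v) }

-- K_{a,b}: vertices 0..a-1 form one part, a..a+b-1 the other.
Kbip : ℕ → ℕ → Graph
Kbip a b = record { size = a + b
                  ; adj = λ u v → side (toℕ u) xorᵇ side (toℕ v) }
  where
  side : ℕ → Bool
  side x = x <ᵇ a
  _xorᵇ_ : Bool → Bool → Bool
  true  xorᵇ y = not y
  false xorᵇ y = y

-- Vertex i lies in copy
-- i / (δ+1) at position i % (δ+1) of that copy of K_{δ+1}; the specified
-- vertex of each copy is position 0; the star centre is the specified vertex
-- of copy 0.  Edges: distinct vertices in the same copy, or two distinct
-- specified vertices one of which is in copy 0.
G₁ : ℕ → ℕ → Graph
G₁ δ k = record { size = suc δ * k ; adj = λ u v → e (toℕ u) (toℕ v) }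
  where
  blk pos : ℕ → ℕ
  blk x = x / suc δ
  pos x = x % suc δ
  e : ℕ → ℕ → Bool
  e x y = (neqᵇ x y ∧ (blk x ≡ᵇ blk y))
        ∨ ((pos x ≡ᵇ 0) ∧ (pos y ≡ᵇ 0) ∧ neqᵇ (blk x) (blk y)
            ∧ ((blk x ≡ᵇ 0) ∨ (blk y ≡ᵇ 0)))

-- For fixed n and large q, hom(G, K_q) = q^n − e(G)·q^(n−1) + O(q^(n−2)), so the graph with fewer
-- edges wins; the proof makes this effective. Colouring G₁ greedily from its last vertex gives
-- hom(G₁, K_q) ≥ ∏_u (q − d_u) ≥ q^n − E·q^(n−1) (Weierstrass), where d_u counts the later
-- neighbours of u and E = ∑ d_u ≤ k − 1 + kδ² with k = n/(δ+1). Colouring the δ-side of K_{δ,b}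
-- first, hom(K_{δ,b}, K_q) ≤ q^δ (q − δ)^b + R·q^(n−1) with R depending only on δ, and Bernoulli's
-- inequality (q − δ)^b (q + bδ) ≤ q^(b+1) makes the main term lose about bδ·q^(n−1) ≈ (δ+1)kδ·q^(n−1).
-- For k large this loss exceeds (E + R)·q^(n−1).

module Submission where

open import Defs
open import Data.Bool using (Bool; true; false; T; not; _∧_; _∨_; _xor_)
open import Data.Bool.Properties using (T-∧; T-∨; ∨-zeroʳ)
open import Data.Empty using (⊥-elim)
open import Data.Fin using (Fin; toℕ) renaming (zero to fzero; suc to fsuc)
open import Data.Fin.Properties using (toℕ-injective; toℕ<n)
open import Data.List using (List; []; _∷_; _++_; map; concatMap; length; filter; allFin; upTo)
open import Data.List.Properties using (map-cong; map-tabulate; length-map; length-++; length-upTo; length-tabulate)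
open import Data.List.Membership.Propositional using (_∈_)
open import Data.List.Membership.Propositional.Properties
  using (∈-map⁺; ∈-++⁺ˡ; ∈-++⁺ʳ; ∈-upTo⁺; ∈-allFin; ∈-filter⁺)
open import Data.List.Relation.Unary.All as All using (All; []; _∷_)
open import Data.List.Relation.Unary.All.Properties using (all⁺; all⁻)
open import Data.List.Relation.Unary.Any using (here; there)
open import Data.List.Relation.Unary.Any.Properties using (¬Any[])
open import Data.List.Relation.Unary.Unique.Propositional using (Unique; []; _∷_)
open import Data.Nat
open import Data.Nat.DivMod
open import Data.Nat.ListAction using (sum)
open import Data.Nat.Properties
open import Data.Nat.Tactic.RingSolver using (solve-∀)
open import Algebra.Properties.CommutativeSemigroup +-commutativeSemigroup
  using () renaming (x∙yz≈y∙xz to x+[y+z]≡y+[x+z])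
open import Algebra.Properties.CommutativeSemigroup *-commutativeSemigroup
  using () renaming (x∙yz≈y∙xz to x*[y*z]≡y*[x*z]; xy∙z≈xz∙y to x*y*z≡x*z*y)
open import Data.Product using (∃; _×_; _,_; proj₁; proj₂)
open import Data.Sum as Sum using (_⊎_; inj₁; inj₂)
open import Function using (_∘_; id)
open import Function.Bundles using (Equivalence)
open import Relation.Binary.PropositionalEquality
open import Relation.Nullary using (¬_; yes; no)
open import Relation.Nullary.Decidable using (T?)

open Equivalence using (to; from)

private
  variable
    A B : Set

count : (A → Bool) → List A → ℕ
count p xs = length (filter (λ x → T? (p x)) xs)

count≤length : (p : A → Bool) (xs : List A) → count p xs ≤ length xs
count≤length p []       = z≤n
count≤length p (x ∷ xs) with p x
... | true  = s≤s (count≤length p xs)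
... | false = m≤n⇒m≤1+n (count≤length p xs)

count-mono : {p r : A → Bool} → (∀ x → T (p x) → T (r x)) → ∀ xs → count p xs ≤ count r xs
count-mono p⇒r []       = z≤n
count-mono {p = p} {r} p⇒r (x ∷ xs) with p x in px | r x in rx
... | true  | true  = s≤s (count-mono p⇒r xs)
... | true  | false = ⊥-elim (subst T rx (p⇒r x (subst T (sym px) _)))
... | false | true  = m≤n⇒m≤1+n (count-mono p⇒r xs)
... | false | false = count-mono p⇒r xs

count-∨ : (p r : A → Bool) (xs : List A) → count (λ x → p x ∨ r x) xs ≤ count p xs + count r xs
count-∨ p r []       = z≤n
count-∨ p r (x ∷ xs) with p x | r x
... | true  | true  = s≤s (≤-trans (count-∨ p r xs) (+-monoʳ-≤ (count p xs) (n≤1+n _)))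
... | true  | false = s≤s (count-∨ p r xs)
... | false | true  = ≤-trans (s≤s (count-∨ p r xs)) (≤-reflexive (sym (+-suc _ _)))
... | false | false = count-∨ p r xs

count-none : (p : A → Bool) → (∀ x → ¬ T (p x)) → ∀ xs → count p xs ≡ 0
count-none p ¬p []       = refl
count-none p ¬p (x ∷ xs) with p x in px
... | true  = ⊥-elim (¬p x (subst T (sym px) _))
... | false = count-none p ¬p xs

count-++ : (p : A → Bool) (xs ys : List A) → count p (xs ++ ys) ≡ count p xs + count p ys
count-++ p []       ys = refl
count-++ p (x ∷ xs) ys with p x
... | true  = cong suc (count-++ p xs ys)
... | false = count-++ p xs ys

count-map : (p : B → Bool) (g : A → B) (xs : List A) →
  count p (map g xs) ≡ count (p ∘ g) xs
count-map p g []       = refl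
count-map p g (x ∷ xs) with p (g x)
... | true  = cong suc (count-map p g xs)
... | false = count-map p g xs

count-concatMap : (p : B → Bool) (g : A → List B) (xs : List A) →
  count p (concatMap g xs) ≡ sum (map (λ x → count p (g x)) xs)
count-concatMap p g []       = refl
count-concatMap p g (x ∷ xs) =
  trans (count-++ p (g x) (concatMap g xs)) (cong (count p (g x) +_) (count-concatMap p g xs))

count-≤-+ : {p r s : A → Bool} → (∀ x → T (p x) → T (r x) ⊎ T (s x)) →
  ∀ xs → count p xs ≤ count r xs + count s xs
count-≤-+ {r = r} {s} p⇒r∨s xs =
  ≤-trans (count-mono (λ x → from T-∨ ∘ p⇒r∨s x) xs) (count-∨ r s xs)

sum-map-mono : {h g : A → ℕ} → (∀ x → h x ≤ g x) → ∀ xs → sum (map h xs) ≤ sum (map g xs)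
sum-map-mono h≤g []       = z≤n
sum-map-mono h≤g (x ∷ xs) = +-mono-≤ (h≤g x) (sum-map-mono h≤g xs)

sum-map-*ˡ : (k : ℕ) (h : A → ℕ) (xs : List A) → sum (map (λ x → k * h x) xs) ≡ k * sum (map h xs)
sum-map-*ˡ k h []       = sym (*-zeroʳ k)
sum-map-*ˡ k h (x ∷ xs) = trans (cong (k * h x +_) (sum-map-*ˡ k h xs)) (sym (*-distribˡ-+ k (h x) _))

*-count≤sum-map : (h : A → ℕ) (p : A → Bool) (r : ℕ) → (∀ x → T (p x) → r ≤ h x) →
  ∀ xs → r * count p xs ≤ sum (map h xs)
*-count≤sum-map h p r r≤h []       = ≤-reflexive (*-zeroʳ r)
*-count≤sum-map h p r r≤h (x ∷ xs) with p x in px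
... | true  = ≤-trans (≤-reflexive (*-suc r _))
                      (+-mono-≤ (r≤h x (subst T (sym px) _)) (*-count≤sum-map h p r r≤h xs))
... | false = ≤-trans (*-count≤sum-map h p r r≤h xs) (m≤n+m _ (h x))

sum-map≤*-count : (h : A → ℕ) (p : A → Bool) (r : ℕ) →
  (∀ x → ¬ T (p x) → h x ≡ 0) → (∀ x → T (p x) → h x ≤ r) →
  ∀ xs → sum (map h xs) ≤ r * count p xs
sum-map≤*-count h p r h≡0 h≤r []       = z≤n
sum-map≤*-count h p r h≡0 h≤r (x ∷ xs) with p x in px
... | true  = ≤-trans (+-mono-≤ (h≤r x (subst T (sym px) _)) (sum-map≤*-count h p r h≡0 h≤r xs))
                      (≤-reflexive (sym (*-suc r _)))
... | false = ≤-trans (≤-reflexive (cong (_+ sum (map h xs)) (h≡0 x (subst T px))))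
                      (sum-map≤*-count h p r h≡0 h≤r xs)

sum-map≤-split : (h : A → ℕ) (p : A → Bool) (u₁ u₀ : ℕ) →
  (∀ x → T (p x) → h x ≤ u₁) → (∀ x → ¬ T (p x) → h x ≤ u₀) →
  ∀ xs → sum (map h xs) ≤ count p xs * u₁ + count (not ∘ p) xs * u₀
sum-map≤-split h p u₁ u₀ h≤u₁ h≤u₀ []       = z≤n
sum-map≤-split h p u₁ u₀ h≤u₁ h≤u₀ (x ∷ xs) with p x in px
... | true  = ≤-trans (+-mono-≤ (h≤u₁ x (subst T (sym px) _)) (sum-map≤-split h p u₁ u₀ h≤u₁ h≤u₀ xs))
                      (≤-reflexive (sym (+-assoc u₁ _ _)))
... | false = ≤-trans (+-mono-≤ (h≤u₀ x (subst T px)) (sum-map≤-split h p u₁ u₀ h≤u₁ h≤u₀ xs))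
                      (≤-reflexive (x+[y+z]≡y+[x+z] u₀ (count p xs * u₁) (count (not ∘ p) xs * u₀)))

sum-map-count-comm : (R : A → B → Bool) (xs : List A) (ys : List B) →
  sum (map (λ x → count (R x) ys) xs) ≡ sum (map (λ y → count (λ x → R x y) xs) ys)
sum-map-count-comm R []       ys = sym (sum-map-zero ys)
  where
  sum-map-zero : ∀ ys → sum (map (λ y → count (λ x → R x y) []) ys) ≡ 0
  sum-map-zero []       = refl
  sum-map-zero (_ ∷ ys) = sum-map-zero ys
sum-map-count-comm R (x ∷ xs) ys =
  trans (cong (count (R x) ys +_) (sum-map-count-comm R xs ys)) (sym (split ys))
  where
  split : ∀ ys → sum (map (λ y → count (λ x′ → R x′ y) (x ∷ xs)) ys)
               ≡ count (R x) ys + sum (map (λ y → count (λ x′ → R x′ y) xs) ys)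
  split []       = refl
  split (y ∷ ys) with R x y
  ... | true  = cong suc (trans (cong (count (λ x′ → R x′ y) xs +_) (split ys))
                                (x+[y+z]≡y+[x+z] (count (λ x′ → R x′ y) xs) (count (R x) ys) _))
  ... | false = trans (cong (count (λ x′ → R x′ y) xs +_) (split ys))
                      (x+[y+z]≡y+[x+z] (count (λ x′ → R x′ y) xs) (count (R x) ys) _)

count-const-true : (xs : List A) → count (λ _ → true) xs ≡ length xs
count-const-true []       = refl
count-const-true (x ∷ xs) = cong suc (count-const-true xs)

allFin-suc : ∀ n → allFin (suc n) ≡ fzero ∷ map fsuc (allFin n)
allFin-suc n = cong (fzero ∷_) (sym (map-tabulate id fsuc))

count-allFin-suc : ∀ n (p : Fin (suc n) → Bool) →
  count p (allFin (suc n)) ≡ count p (fzero ∷ []) + count (p ∘ fsuc) (allFin n)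
count-allFin-suc n p = begin
  count p (allFin (suc n))
    ≡⟨ cong (count p) (allFin-suc n) ⟩
  count p ((fzero ∷ []) ++ map fsuc (allFin n))
    ≡⟨ count-++ p (fzero ∷ []) _ ⟩
  count p (fzero ∷ []) + count p (map fsuc (allFin n))
    ≡⟨ cong (count p (fzero ∷ []) +_) (count-map p fsuc (allFin n)) ⟩
  count p (fzero ∷ []) + count (p ∘ fsuc) (allFin n) ∎
  where open ≡-Reasoning

count-allFin : ∀ n → count (λ (_ : Fin n) → true) (allFin n) ≡ n
count-allFin n = trans (count-const-true (allFin n)) (length-tabulate id)

count-allFin≤ : ∀ n (p : Fin n → Bool) → count p (allFin n) ≤ n
count-allFin≤ n p = ≤-trans (count≤length p (allFin n)) (≤-reflexive (length-tabulate id))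

neqᵇ⇒≢ : ∀ {a b} → T (neqᵇ a b) → a ≢ b
neqᵇ⇒≢ {a} t refl with a ≡ᵇ a | ≡⇒≡ᵇ a a refl
... | true | _ = t

≢⇒neqᵇ : ∀ {a b} → a ≢ b → T (neqᵇ a b)
≢⇒neqᵇ {a} {b} a≢b with a ≡ᵇ b in a≡ᵇb
... | true  = a≢b (≡ᵇ⇒≡ a b (subst T (sym a≡ᵇb) _))
... | false = _

module _ {q : ℕ} {c c′ : Fin q} where

  colour-neqᵇ⇒≢ : T (neqᵇ (toℕ c) (toℕ c′)) → c ≢ c′
  colour-neqᵇ⇒≢ t c≡c′ = neqᵇ⇒≢ t (cong toℕ c≡c′)

  ≢⇒colour-neqᵇ : c ≢ c′ → T (neqᵇ (toℕ c) (toℕ c′))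
  ≢⇒colour-neqᵇ c≢c′ = ≢⇒neqᵇ (c≢c′ ∘ toℕ-injective)

T-not-∨-elim : ∀ {a b} → T (not a ∨ b) → T a → T b
T-not-∨-elim {true} t _ = t

T-not-∨-intro : ∀ {a b} → (T a → T b) → T (not a ∨ b)
T-not-∨-intro {true}  a⇒b = a⇒b _
T-not-∨-intro {false} a⇒b = _

module _ {n : ℕ} {p : Fin n → Bool} where

  allᵇ-allFin⇒ : T (allᵇ p (allFin n)) → ∀ i → T (p i)
  allᵇ-allFin⇒ t i = All.lookup (all⁺ p (allFin n) t) (∈-allFin i)

  ⇒allᵇ-allFin : (∀ i → T (p i)) → T (allᵇ p (allFin n))
  ⇒allᵇ-allFin h = all⁻ p {allFin n} (All.tabulate (λ {i} _ → h i))

-- The extension map used by allMaps is local to its definition, so it is recovered by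
-- unification; (c ◂ f) fzero and (c ◂ f) (fsuc i) reduce to c and f i.
record Prepend (n m : ℕ) : Set where
  field
    _◂_ : Fin m → (Fin n → Fin m) → Fin (suc n) → Fin m
    count-allMaps-suc : (p : (Fin (suc n) → Fin m) → Bool) →
      count p (allMaps (suc n) m) ≡ sum (map (λ f → count (λ c → p (c ◂ f)) (allFin m)) (allMaps n m))

prepend : ∀ n m → Prepend n m
prepend n m = record
  { count-allMaps-suc = λ p →
      trans (count-concatMap p _ (allMaps n m)) (cong sum (map-cong (λ f → count-map p _ (allFin m)) (allMaps n m)))
  }

module _ {n m : ℕ} where
  open Prepend (prepend n m)

  count-allMaps-suc′ : (p : (Fin (suc n) → Fin m) → Bool) →
    count p (allMaps (suc n) m) ≡ sum (map (λ c → count (λ f → p (c ◂ f)) (allMaps n m)) (allFin m))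
  count-allMaps-suc′ p =
    trans (count-allMaps-suc p) (sum-map-count-comm (λ f c → p (c ◂ f)) (allMaps n m) (allFin m))

count-allMaps-all≤ : ∀ {q} m (P : Fin q → Bool) →
  count (λ g → allᵇ (P ∘ g) (allFin m)) (allMaps m q) ≤ count P (allFin q) ^ m
count-allMaps-all≤         zero    P = ≤-refl
count-allMaps-all≤ {q} (suc m) P = begin
  count all-P (allMaps (suc m) q)
    ≡⟨ count-allMaps-suc all-P ⟩
  sum (map (λ f → count (λ c → all-P (c ◂ f)) (allFin q)) (allMaps m q))
    ≤⟨ sum-map≤*-count _ all-P′ (count P (allFin q)) none-if-tail-fails at-most-P (allMaps m q) ⟩
  count P (allFin q) * count all-P′ (allMaps m q)
    ≤⟨ *-monoʳ-≤ (count P (allFin q)) (count-allMaps-all≤ m P) ⟩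
  count P (allFin q) * count P (allFin q) ^ m ∎
  where
  open ≤-Reasoning
  open Prepend (prepend m q)
  all-P : (Fin (suc m) → Fin q) → Bool
  all-P g = allᵇ (P ∘ g) (allFin (suc m))
  all-P′ : (Fin m → Fin q) → Bool
  all-P′ g = allᵇ (P ∘ g) (allFin m)
  tail : ∀ c f → T (all-P (c ◂ f)) → T (all-P′ f)
  tail c f t = ⇒allᵇ-allFin (λ j → allᵇ-allFin⇒ {p = P ∘ (c ◂ f)} t (fsuc j))
  none-if-tail-fails : ∀ f → ¬ T (all-P′ f) → count (λ c → all-P (c ◂ f)) (allFin q) ≡ 0
  none-if-tail-fails f ¬f = count-none _ (λ c t → ¬f (tail c f t)) (allFin q)
  at-most-P : ∀ f → T (all-P′ f) → count (λ c → all-P (c ◂ f)) (allFin q) ≤ count P (allFin q)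
  at-most-P f _ = count-mono (λ c t → allᵇ-allFin⇒ {p = P ∘ (c ◂ f)} t fzero) (allFin q)

count-toℕ≡ᵇ≤1 : ∀ q x → count (λ (c : Fin q) → toℕ c ≡ᵇ x) (allFin q) ≤ 1
count-toℕ≡ᵇ≤1 zero    x       = z≤n
count-toℕ≡ᵇ≤1 (suc q) zero    rewrite count-allFin-suc q (λ c → toℕ c ≡ᵇ 0) =
  s≤s (≤-reflexive (count-none _ (λ _ ()) (allFin q)))
count-toℕ≡ᵇ≤1 (suc q) (suc x) rewrite count-allFin-suc q (λ c → toℕ c ≡ᵇ suc x) =
  count-toℕ≡ᵇ≤1 q x

count-allFin≤length : ∀ {n} (p : Fin n → Bool) (L : List ℕ) → (∀ j → T (p j) → toℕ j ∈ L) →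
  count p (allFin n) ≤ length L
count-allFin≤length {n} p []      p⇒∈ = ≤-reflexive (count-none p (λ j → ¬Any[] ∘ p⇒∈ j) (allFin n))
count-allFin≤length {n} p (x ∷ L) p⇒∈ =
  ≤-trans (count-≤-+ split (allFin n)) (+-mono-≤ (count-toℕ≡ᵇ≤1 n x) (count-allFin≤length p′ L p′⇒∈))
  where
  p′ : Fin n → Bool
  p′ j = p j ∧ neqᵇ (toℕ j) x
  split : ∀ j → T (p j) → T (toℕ j ≡ᵇ x) ⊎ T (p′ j)
  split j pj with toℕ j ≡ᵇ x
  ... | true  = inj₁ _
  ... | false = inj₂ (from T-∧ (pj , _))
  p′⇒∈ : ∀ j → T (p′ j) → toℕ j ∈ L
  p′⇒∈ j t with to T-∧ t
  ... | pj , j≢x with p⇒∈ j pj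
  ...   | here j≡x = ⊥-elim (neqᵇ⇒≢ j≢x j≡x)
  ...   | there j∈L = j∈L

count≤1+count-neqᵇ-∧ : ∀ q x (p : Fin q → Bool) →
  count p (allFin q) ≤ suc (count (λ c → neqᵇ (toℕ c) x ∧ p c) (allFin q))
count≤1+count-neqᵇ-∧ q x p =
  ≤-trans (count-≤-+ split (allFin q)) (+-monoˡ-≤ _ (count-toℕ≡ᵇ≤1 q x))
  where
  split : ∀ c → T (p c) → T (toℕ c ≡ᵇ x) ⊎ T (neqᵇ (toℕ c) x ∧ p c)
  split c pc with toℕ c ≡ᵇ x
  ... | true  = inj₁ _
  ... | false = inj₂ pc

count-neqᵇ-∧< : ∀ q (x : Fin q) (p : Fin q → Bool) → T (p x) →
  count (λ c → neqᵇ (toℕ c) (toℕ x) ∧ p c) (allFin q) < count p (allFin q)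
count-neqᵇ-∧< (suc q) fzero p px
  rewrite count-allFin-suc q p | count-allFin-suc q (λ c → neqᵇ (toℕ c) 0 ∧ p c) with p fzero
... | true = s≤s (count-mono (λ _ t → t) (allFin q))
count-neqᵇ-∧< (suc q) (fsuc x) p px
  rewrite count-allFin-suc q p | count-allFin-suc q (λ c → neqᵇ (toℕ c) (suc (toℕ x)) ∧ p c) with p fzero
... | true  = s≤s (count-neqᵇ-∧< q x (p ∘ fsuc) px)
... | false = count-neqᵇ-∧< q x (p ∘ fsuc) px

module _ {q : ℕ} where

  avoids : List (Fin q) → Fin q → Bool
  avoids F c = allᵇ (λ y → neqᵇ (toℕ c) (toℕ y)) F

  avoids⇒≢ : ∀ {F c y} → T (avoids F c) → y ∈ F → c ≢ y
  avoids⇒≢ {F} t y∈F = colour-neqᵇ⇒≢ (All.lookup (all⁺ _ F t) y∈F)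

  All≢⇒avoids : ∀ {F c} → All (c ≢_) F → T (avoids F c)
  All≢⇒avoids c∉F = all⁻ _ (All.map ≢⇒colour-neqᵇ c∉F)

  ∸-length≤count-avoids : (F : List (Fin q)) → q ∸ length F ≤ count (avoids F) (allFin q)
  ∸-length≤count-avoids []      = ≤-reflexive (sym (count-allFin q))
  ∸-length≤count-avoids (y ∷ F) = begin
    q ∸ suc (length F)              ≡⟨ pred[m∸n]≡m∸[1+n] q (length F) ⟨
    pred (q ∸ length F)             ≤⟨ pred-mono-≤ (∸-length≤count-avoids F) ⟩
    pred (count (avoids F) (allFin q)) ≤⟨ pred-mono-≤ (count≤1+count-neqᵇ-∧ q (toℕ y) (avoids F)) ⟩
    count (avoids (y ∷ F)) (allFin q) ∎
    where open ≤-Reasoning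

  count-not-avoids≤length : (F : List (Fin q)) → count (not ∘ avoids F) (allFin q) ≤ length F
  count-not-avoids≤length []      = ≤-reflexive (count-none _ (λ _ ()) (allFin q))
  count-not-avoids≤length (y ∷ F) =
    ≤-trans (count-≤-+ split (allFin q)) (+-mono-≤ (count-toℕ≡ᵇ≤1 q (toℕ y)) (count-not-avoids≤length F))
    where
    split : ∀ c → T (not (avoids (y ∷ F) c)) → T (toℕ c ≡ᵇ toℕ y) ⊎ T (not (avoids F c))
    split c t with toℕ c ≡ᵇ toℕ y
    ... | true  = inj₁ _
    ... | false = inj₂ t

  count-avoids+length≤ : (F : List (Fin q)) → Unique F → count (avoids F) (allFin q) + length F ≤ q
  count-avoids+length≤ []      _            = ≤-reflexive (trans (+-identityʳ _) (count-allFin q))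
  count-avoids+length≤ (y ∷ F) (y∉F ∷ uniq) = begin
    count (avoids (y ∷ F)) (allFin q) + suc (length F)
      ≡⟨ +-suc _ (length F) ⟩
    suc (count (avoids (y ∷ F)) (allFin q) + length F)
      ≤⟨ +-monoˡ-≤ (length F) (count-neqᵇ-∧< q y (avoids F) (All≢⇒avoids y∉F)) ⟩
    count (avoids F) (allFin q) + length F
      ≤⟨ count-avoids+length≤ F uniq ⟩
    q ∎
    where open ≤-Reasoning

Adj : ℕ → Set
Adj n = Fin n → Fin n → Bool

module _ {n q : ℕ} where

  properᵇ : Adj n → (Fin n → Fin q) → Bool
  properᵇ E g =
    allᵇ (λ u → allᵇ (λ v → not (E u v) ∨ neqᵇ (toℕ (g u)) (toℕ (g v))) (allFin n)) (allFin n)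

  IsProper : Adj n → (Fin n → Fin q) → Set
  IsProper E g = ∀ u v → T (E u v) → g u ≢ g v

  properᵇ⇒IsProper : ∀ {E g} → T (properᵇ E g) → IsProper E g
  properᵇ⇒IsProper t u v e = colour-neqᵇ⇒≢ (T-not-∨-elim (allᵇ-allFin⇒ (allᵇ-allFin⇒ t u) v) e)

  IsProper⇒properᵇ : ∀ {E g} → IsProper E g → T (properᵇ E g)
  IsProper⇒properᵇ proper =
    ⇒allᵇ-allFin (λ u → ⇒allᵇ-allFin (λ v → T-not-∨-intro (≢⇒colour-neqᵇ ∘ proper u v)))

  properᵇ-antitone : ∀ {E E′ g} → (∀ u v → T (E′ u v) → T (E u v)) →
    T (properᵇ E g) → T (properᵇ E′ g)
  properᵇ-antitone {E} {E′} {g} E′⇒E t =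
    IsProper⇒properᵇ {E′} {g} (λ u v → properᵇ⇒IsProper {E} {g} t u v ∘ E′⇒E u v)

∏< : ℕ → (ℕ → ℕ) → ℕ
∏< zero    h = 1
∏< (suc n) h = h 0 * ∏< n (h ∘ suc)

∑< : ℕ → (ℕ → ℕ) → ℕ
∑< zero    h = 0
∑< (suc n) h = h 0 + ∑< n (h ∘ suc)

module _ {n : ℕ} where

  Loopless : Adj n → Set
  Loopless E = ∀ u → ¬ T (E u u)

  laterDegree : Adj n → Fin n → ℕ
  laterDegree E u = count (λ v → (toℕ u <ᵇ toℕ v) ∧ (E u v ∨ E v u)) (allFin n)

delete-first : {n : ℕ} → Adj (suc n) → Adj n
delete-first E i j = E (fsuc i) (fsuc j)

laterDegree-delete-first : ∀ {n} (E : Adj (suc n)) i → laterDegree (delete-first E) i ≡ laterDegree E (fsuc i)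
laterDegree-delete-first {n} E i =
  sym (count-allFin-suc n (λ v → (suc (toℕ i) <ᵇ toℕ v) ∧ (E (fsuc i) v ∨ E v (fsuc i))))

-- Colour the vertices from last to first: vertex u then has at most d u coloured neighbours.
greedy-colourings : ∀ {n q} (E : Adj n) (d : ℕ → ℕ) →
  Loopless E → (∀ u → laterDegree E u ≤ d (toℕ u)) →
  ∏< n (λ u → q ∸ d u) ≤ count (properᵇ E) (allMaps n q)
greedy-colourings {zero}      E d loopless deg = ≤-refl
greedy-colourings {suc n} {q} E d loopless deg = begin
  (q ∸ d 0) * ∏< n (λ u → q ∸ d (suc u))
    ≤⟨ *-monoʳ-≤ (q ∸ d 0) (greedy-colourings (delete-first E) (d ∘ suc) (loopless ∘ fsuc) deg′) ⟩
  (q ∸ d 0) * count (properᵇ (delete-first E)) (allMaps n q)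
    ≤⟨ *-count≤sum-map _ (properᵇ (delete-first E)) (q ∸ d 0) extensions (allMaps n q) ⟩
  sum (map (λ f → count (λ c → properᵇ E (c ◂ f)) (allFin q)) (allMaps n q))
    ≡⟨ count-allMaps-suc (properᵇ E) ⟨
  count (properᵇ E) (allMaps (suc n) q) ∎
  where
  open ≤-Reasoning
  open Prepend (prepend n q)

  deg′ : ∀ i → laterDegree (delete-first E) i ≤ d (suc (toℕ i))
  deg′ i = ≤-trans (≤-reflexive (laterDegree-delete-first E i)) (deg (fsuc i))

  adjacent-to-first : Fin n → Bool
  adjacent-to-first j = E fzero (fsuc j) ∨ E (fsuc j) fzero

  forbidden : (Fin n → Fin q) → List (Fin q)
  forbidden f = map f (filter (λ j → T? (adjacent-to-first j)) (allFin n))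

  length-forbidden : ∀ f → length (forbidden f) ≤ d 0
  length-forbidden f = begin
    length (forbidden f)
      ≡⟨ length-map f (filter (λ j → T? (adjacent-to-first j)) (allFin n)) ⟩
    count adjacent-to-first (allFin n)
      ≡⟨ count-allFin-suc n (λ v → (0 <ᵇ toℕ v) ∧ (E fzero v ∨ E v fzero)) ⟨
    laterDegree E fzero
      ≤⟨ deg fzero ⟩
    d 0 ∎

  extend-proper : ∀ c f → T (avoids (forbidden f) c) → T (properᵇ (delete-first E) f) → IsProper E (c ◂ f)
  extend-proper c f c-avoids f-proper fzero    fzero    e = ⊥-elim (loopless fzero e)
  extend-proper c f c-avoids f-proper fzero    (fsuc j) e =
    avoids⇒≢ c-avoids (∈-map⁺ f (∈-filter⁺ _ (∈-allFin j) (from T-∨ (inj₁ e))))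
  extend-proper c f c-avoids f-proper (fsuc i) fzero    e =
    ≢-sym (avoids⇒≢ c-avoids (∈-map⁺ f (∈-filter⁺ _ (∈-allFin i) (from T-∨ (inj₂ e)))))
  extend-proper c f c-avoids f-proper (fsuc i) (fsuc j) e = properᵇ⇒IsProper f-proper i j e

  extensions : ∀ f → T (properᵇ (delete-first E) f) → q ∸ d 0 ≤ count (λ c → properᵇ E (c ◂ f)) (allFin q)
  extensions f f-proper = begin
    q ∸ d 0
      ≤⟨ ∸-monoʳ-≤ q (length-forbidden f) ⟩
    q ∸ length (forbidden f)
      ≤⟨ ∸-length≤count-avoids (forbidden f) ⟩
    count (avoids (forbidden f)) (allFin q)
      ≤⟨ count-mono (λ c t → IsProper⇒properᵇ (extend-proper c f t f-proper)) (allFin q) ⟩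
    count (λ c → properᵇ E (c ◂ f)) (allFin q) ∎

∑<-cong : ∀ n {h g : ℕ → ℕ} → (∀ u → h u ≡ g u) → ∑< n h ≡ ∑< n g
∑<-cong zero    h≡g = refl
∑<-cong (suc n) h≡g = cong₂ _+_ (h≡g 0) (∑<-cong n (h≡g ∘ suc))

∑<-≤ : ∀ n (h : ℕ → ℕ) c → (∀ u → u < n → h u ≤ c) → ∑< n h ≤ n * c
∑<-≤ zero    h c h≤c = z≤n
∑<-≤ (suc n) h c h≤c = +-mono-≤ (h≤c 0 z<s) (∑<-≤ n (h ∘ suc) c (λ u u<n → h≤c (suc u) (s≤s u<n)))

∑<-+ : ∀ m n (h : ℕ → ℕ) → ∑< (m + n) h ≡ ∑< m h + ∑< n (λ u → h (m + u))
∑<-+ zero    n h = refl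
∑<-+ (suc m) n h = trans (cong (h 0 +_) (∑<-+ m n (h ∘ suc))) (sym (+-assoc (h 0) _ _))

∑<-periodic : ∀ p k (h : ℕ → ℕ) → (∀ u → h (p + u) ≡ h u) → ∑< (p * k) h ≡ k * ∑< p h
∑<-periodic p zero    h periodic = cong (λ z → ∑< z h) (*-zeroʳ p)
∑<-periodic p (suc k) h periodic = begin
  ∑< (p * suc k) h                              ≡⟨ cong (λ z → ∑< z h) (*-suc p k) ⟩
  ∑< (p + p * k) h                              ≡⟨ ∑<-+ p (p * k) h ⟩
  ∑< p h + ∑< (p * k) (λ u → h (p + u))         ≡⟨ cong (∑< p h +_) (∑<-cong (p * k) periodic) ⟩
  ∑< p h + ∑< (p * k) h                         ≡⟨ cong (∑< p h +_) (∑<-periodic p k h periodic) ⟩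
  ∑< p h + k * ∑< p h                           ∎
  where open ≡-Reasoning

∏<-∸≤^ : ∀ q n (d : ℕ → ℕ) → ∏< n (λ u → q ∸ d u) ≤ q ^ n
∏<-∸≤^ q zero    d = ≤-refl
∏<-∸≤^ q (suc n) d = *-mono-≤ (m∸n≤m q (d 0)) (∏<-∸≤^ q n (d ∘ suc))

-- The Weierstrass product inequality ∏ (1 - x_u) ≥ 1 - ∑ x_u with x_u = d u / q, cleared of denominators.
weierstrass-product : ∀ q n (d : ℕ → ℕ) → (∀ u → u < n → d u ≤ q) →
  q ^ suc n ≤ q * ∏< n (λ u → q ∸ d u) + ∑< n d * q ^ n
weierstrass-product q zero    d d≤q = ≤-reflexive (sym (+-identityʳ _))
weierstrass-product q (suc n) d d≤q = begin
  q * q ^ suc n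
    ≤⟨ *-monoʳ-≤ q (weierstrass-product q n (d ∘ suc) (λ u u<n → d≤q (suc u) (s≤s u<n))) ⟩
  q * (q * P + S * q ^ n)
    ≡⟨ cong (λ z → q * (z * P + S * q ^ n)) (m∸n+n≡m (d≤q 0 z<s)) ⟨
  q * ((q ∸ d 0 + d 0) * P + S * q ^ n)
    ≡⟨ rearrange q (q ∸ d 0) (d 0) P S (q ^ n) ⟩
  q * ((q ∸ d 0) * P) + (d 0 * (q * P) + S * (q * q ^ n))
    ≤⟨ +-monoʳ-≤ (q * ((q ∸ d 0) * P)) (+-monoˡ-≤ (S * (q * q ^ n)) (*-monoʳ-≤ (d 0) (*-monoʳ-≤ q P≤))) ⟩
  q * ((q ∸ d 0) * P) + (d 0 * (q * q ^ n) + S * (q * q ^ n))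
    ≡⟨ cong (q * ((q ∸ d 0) * P) +_) (*-distribʳ-+ (q * q ^ n) (d 0) S) ⟨
  q * ((q ∸ d 0) * P) + (d 0 + S) * (q * q ^ n) ∎
  where
  open ≤-Reasoning
  P = ∏< n (λ u → q ∸ d (suc u))
  S = ∑< n (d ∘ suc)
  P≤ : P ≤ q ^ n
  P≤ = ∏<-∸≤^ q n (d ∘ suc)
  rearrange : ∀ q x d P S Q → q * ((x + d) * P + S * Q) ≡ q * (x * P) + (d * (q * P) + S * (q * Q))
  rearrange = solve-∀

bernoulli : ∀ q δ b → q ^ b * (q + b * δ) ≤ q * (q + δ) ^ b
bernoulli q δ zero    = ≤-reflexive (solve q)
  where
  solve : ∀ q → 1 * (q + 0) ≡ q * 1
  solve = solve-∀
bernoulli q δ (suc b) = begin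
  q * q ^ b * (q + (δ + b * δ))
    ≡⟨ rearrange q (q ^ b) δ (b * δ) ⟩
  q * (q ^ b * (q + b * δ)) + δ * (q ^ b * q)
    ≤⟨ +-monoʳ-≤ (q * (q ^ b * (q + b * δ))) (*-monoʳ-≤ δ (*-monoʳ-≤ (q ^ b) (m≤m+n q (b * δ)))) ⟩
  q * (q ^ b * (q + b * δ)) + δ * (q ^ b * (q + b * δ))
    ≡⟨ *-distribʳ-+ _ q δ ⟨
  (q + δ) * (q ^ b * (q + b * δ))
    ≤⟨ *-monoʳ-≤ (q + δ) (bernoulli q δ b) ⟩
  (q + δ) * (q * (q + δ) ^ b)
    ≡⟨ x*[y*z]≡y*[x*z] (q + δ) q ((q + δ) ^ b) ⟩
  q * ((q + δ) * (q + δ) ^ b) ∎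
  where
  open ≤-Reasoning
  rearrange : ∀ q Q δ B → q * Q * (q + (δ + B)) ≡ q * (Q * (q + B)) + δ * (Q * q)
  rearrange = solve-∀

[m∸n]*[m+n]≤m*m : ∀ m n → (m ∸ n) * (m + n) ≤ m * m
[m∸n]*[m+n]≤m*m m n with n ≤? m
... | no  n≰m = ≤-trans (≤-reflexive (cong (_* (m + n)) (m≤n⇒m∸n≡0 (≰⇒≥ n≰m)))) z≤n
... | yes n≤m = begin
  (m ∸ n) * (m + n)           ≡⟨ cong (λ z → x * (z + n)) (m∸n+n≡m n≤m) ⟨
  x * (x + n + n)             ≤⟨ m≤m+n (x * (x + n + n)) (n * n) ⟩
  x * (x + n + n) + n * n     ≡⟨ square x n ⟩
  (x + n) * (x + n)           ≡⟨ cong (λ z → z * z) (m∸n+n≡m n≤m) ⟩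
  m * m                       ∎
  where
  open ≤-Reasoning
  x = m ∸ n
  square : ∀ x n → x * (x + n + n) + n * n ≡ (x + n) * (x + n)
  square = solve-∀

^-distribʳ-* : ∀ m n o → (m * n) ^ o ≡ m ^ o * n ^ o
^-distribʳ-* m n zero    = refl
^-distribʳ-* m n (suc o) = trans (cong (m * n *_) (^-distribʳ-* m n o)) (rearrange m n (m ^ o) (n ^ o))
  where
  rearrange : ∀ m n M N → m * n * (M * N) ≡ m * M * (n * N)
  rearrange = solve-∀

-- Bernoulli for (q + δ)^b combined with (q - δ)(q + δ) ≤ q².
[q∸δ]^b*[q+b*δ]≤q^[1+b] : ∀ q δ b .{{_ : NonZero q}} → (q ∸ δ) ^ b * (q + b * δ) ≤ q ^ suc b
[q∸δ]^b*[q+b*δ]≤q^[1+b] q δ b = *-cancelˡ-≤ (q ^ b) {{m^n≢0 q b}} (begin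
  q ^ b * ((q ∸ δ) ^ b * (q + b * δ))  ≡⟨ x*[y*z]≡y*[x*z] (q ^ b) ((q ∸ δ) ^ b) (q + b * δ) ⟩
  (q ∸ δ) ^ b * (q ^ b * (q + b * δ))  ≤⟨ *-monoʳ-≤ ((q ∸ δ) ^ b) (bernoulli q δ b) ⟩
  (q ∸ δ) ^ b * (q * (q + δ) ^ b)      ≡⟨ x*[y*z]≡y*[x*z] ((q ∸ δ) ^ b) q ((q + δ) ^ b) ⟩
  q * ((q ∸ δ) ^ b * (q + δ) ^ b)      ≡⟨ cong (q *_) (^-distribʳ-* (q ∸ δ) (q + δ) b) ⟨
  q * ((q ∸ δ) * (q + δ)) ^ b          ≤⟨ *-monoʳ-≤ q (^-monoˡ-≤ b ([m∸n]*[m+n]≤m*m q δ)) ⟩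
  q * (q * q) ^ b                      ≡⟨ cong (q *_) (^-distribʳ-* q q b) ⟩
  q * (q ^ b * q ^ b)                  ≡⟨ x*[y*z]≡y*[x*z] q (q ^ b) (q ^ b) ⟩
  q ^ b * (q * q ^ b)                  ∎)
  where open ≤-Reasoning

-- With W = q + bδ and n = δ + b, Bernoulli gives q·W·H₂ ≤ q^n·(q² + R·W)
-- while q·W·H₁ ≥ q^n·(q·W − E·W); the hypotheses on R + E imply (R + E)·W < bδ·q.
count-comparison : ∀ q δ b R E H₁ H₂ .{{_ : NonZero q}} →
  q * H₂ ≤ q ^ suc δ * (q ∸ δ) ^ b + R * q ^ (δ + b) →
  q ^ suc (δ + b) ≤ q * H₁ + E * q ^ (δ + b) →
  R + E + 1 ≤ b * δ → (R + E) * (b * δ) < q → H₂ < H₁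
count-comparison q δ b R E H₁ H₂ upper lower room large =
  *-cancelˡ-< (q * W) H₂ H₁ (+-cancelʳ-< (E * q ^ n * W) (q * W * H₂) (q * W * H₁) (begin-strict
    q * W * H₂ + E * q ^ n * W
      ≡⟨ cong (_+ E * q ^ n * W) (x*y*z≡x*z*y q W H₂) ⟩
    q * H₂ * W + E * q ^ n * W
      ≤⟨ +-monoˡ-≤ (E * q ^ n * W) (*-monoˡ-≤ W upper) ⟩
    (q ^ suc δ * (q ∸ δ) ^ b + R * q ^ n) * W + E * q ^ n * W
      ≡⟨ rearrange (q ^ suc δ) ((q ∸ δ) ^ b) W R (q ^ n) E ⟩
    q ^ suc δ * ((q ∸ δ) ^ b * W) + q ^ n * ((R + E) * W)
      ≤⟨ +-monoˡ-≤ (q ^ n * ((R + E) * W)) (*-monoʳ-≤ (q ^ suc δ) ([q∸δ]^b*[q+b*δ]≤q^[1+b] q δ b)) ⟩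
    q ^ suc δ * q ^ suc b + q ^ n * ((R + E) * W)
      ≡⟨ cong (_+ q ^ n * ((R + E) * W)) powers ⟩
    q ^ n * (q * q) + q ^ n * ((R + E) * W)
      <⟨ +-monoʳ-< (q ^ n * (q * q)) (*-monoʳ-< (q ^ n) {{m^n≢0 q n}} [R+E]*W<M*q) ⟩
    q ^ n * (q * q) + q ^ n * (M * q)
      ≡⟨ factor (q ^ n) q M ⟩
    q ^ suc n * W
      ≤⟨ *-monoˡ-≤ W lower ⟩
    (q * H₁ + E * q ^ n) * W
      ≡⟨ expand q H₁ E (q ^ n) W ⟩
    q * W * H₁ + E * q ^ n * W ∎))
  where
  open ≤-Reasoning
  n = δ + b
  M = b * δ
  W = q + M
  [R+E]*W<M*q : (R + E) * W < M * q
  [R+E]*W<M*q = begin-strict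
    (R + E) * W                ≡⟨ *-distribˡ-+ (R + E) q M ⟩
    (R + E) * q + (R + E) * M  <⟨ +-monoʳ-< ((R + E) * q) large ⟩
    (R + E) * q + q            ≡⟨ x*q+q≡[x+1]*q (R + E) q ⟩
    (R + E + 1) * q            ≤⟨ *-monoˡ-≤ q room ⟩
    M * q                      ∎
    where
    x*q+q≡[x+1]*q : ∀ x q → x * q + q ≡ (x + 1) * q
    x*q+q≡[x+1]*q = solve-∀
  powers : q ^ suc δ * q ^ suc b ≡ q ^ n * (q * q)
  powers = trans (shuffle q (q ^ δ) (q ^ b)) (cong (_* (q * q)) (sym (^-distribˡ-+-* q δ b)))
    where
    shuffle : ∀ q x y → q * x * (q * y) ≡ x * y * (q * q)
    shuffle = solve-∀
  rearrange : ∀ A B W R Q E → (A * B + R * Q) * W + E * Q * W ≡ A * (B * W) + Q * ((R + E) * W)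
  rearrange = solve-∀
  factor : ∀ Q q M → Q * (q * q) + Q * (M * q) ≡ q * Q * (q + M)
  factor = solve-∀
  expand : ∀ q H E Q W → (q * H + E * Q) * W ≡ q * W * H + E * Q * W
  expand = solve-∀

bipartite : ℕ → {n : ℕ} → Adj n
bipartite a u v = (toℕ u <ᵇ a) xor (toℕ v <ᵇ a)

bipartite⇒Kbip-adj : ∀ a b (u v : Fin (a + b)) → T (bipartite a u v) → T (adj (Kbip a b) u v)
bipartite⇒Kbip-adj a b u v t with toℕ u <ᵇ a | toℕ v <ᵇ a
... | true  | false = _
... | false | true  = _

-- Chosen so that bipartite-bound below satisfies bipartite-bound-step.
bipartite-error : ℕ → ℕ → ℕ
bipartite-error zero    l = 0
bipartite-error (suc a) l = bipartite-error a (suc l) + l + l * bipartite-error a l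

T-∨-∧-dropˡ : ∀ {x y z} → T (x ∨ (y ∧ z)) → T (x ∨ z)
T-∨-∧-dropˡ {true}          _ = _
T-∨-∧-dropˡ {false} {true}  t = t

module _ (b : ℕ) {q : ℕ} .{{_ : NonZero q}} where

  -- F lists the colours of first-side vertices already removed; the second side must avoid them.
  avoiding-colouring : (a : ℕ) → List (Fin q) → (Fin (a + b) → Fin q) → Bool
  avoiding-colouring a F g =
    properᵇ (bipartite a) g ∧ allᵇ (λ j → (toℕ j <ᵇ a) ∨ avoids F (g j)) (allFin (a + b))

  bipartite-bound : ℕ → ℕ → ℕ
  bipartite-bound a l = q ^ suc a * (q ∸ l ∸ a) ^ b + bipartite-error a l * q ^ (a + b)

  bipartite-bound-step : ∀ a l → q * bipartite-bound a (suc l) + l * bipartite-bound a l ≤ bipartite-bound (suc a) l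
  bipartite-bound-step a l = begin
    q * (q ^ suc a * Y ^ b + E₁ * P) + l * (q ^ suc a * Z ^ b + E₀ * P)
      ≤⟨ +-monoʳ-≤ (q * (q ^ suc a * Y ^ b + E₁ * P))
                   (*-monoʳ-≤ l (+-mono-≤ Z-term≤ (*-monoʳ-≤ E₀ (m≤n*m P q)))) ⟩
    q * (q ^ suc a * Y ^ b + E₁ * P) + l * (q * P + E₀ * (q * P))
      ≡⟨ rearrange q (q ^ suc a) (Y ^ b) E₁ P l E₀ ⟩
    q * q ^ suc a * Y ^ b + (E₁ + l + l * E₀) * (q * P)
      ≡⟨ cong (λ z → q * q ^ suc a * z ^ b + (E₁ + l + l * E₀) * (q * P)) Y≡ ⟩
    q ^ suc (suc a) * (q ∸ l ∸ suc a) ^ b + bipartite-error (suc a) l * q ^ (suc a + b) ∎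
    where
    open ≤-Reasoning
    P = q ^ (a + b)
    Y = q ∸ suc l ∸ a
    Z = q ∸ l ∸ a
    E₁ = bipartite-error a (suc l)
    E₀ = bipartite-error a l
    Z-term≤ : q ^ suc a * Z ^ b ≤ q * P
    Z-term≤ = ≤-trans (*-monoʳ-≤ (q ^ suc a) (^-monoˡ-≤ b (≤-trans (m∸n≤m (q ∸ l) a) (m∸n≤m q l))))
                      (≤-reflexive (sym (^-distribˡ-+-* q (suc a) b)))
    Y≡ : q ∸ suc l ∸ a ≡ q ∸ l ∸ suc a
    Y≡ = trans (∸-+-assoc q (suc l) a) (trans (cong (q ∸_) (sym (+-suc l a))) (sym (∸-+-assoc q l (suc a))))
    rearrange : ∀ q Q Yb E₁ P l E₀ → q * (Q * Yb + E₁ * P) + l * (q * P + E₀ * (q * P))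
                                   ≡ q * Q * Yb + (E₁ + l + l * E₀) * (q * P)
    rearrange = solve-∀

  module _ {a : ℕ} where
    open Prepend (prepend (a + b) q)

    avoiding-colouring-restrict : ∀ {F} c f →
      T (avoiding-colouring (suc a) F (c ◂ f)) → T (avoiding-colouring a (c ∷ F) f)
    avoiding-colouring-restrict {F} c f t = from T-∧ (IsProper⇒properᵇ proper-f , ⇒allᵇ-allFin second-side)
      where
      proper : IsProper (bipartite (suc a)) (c ◂ f)
      proper = properᵇ⇒IsProper (proj₁ (to T-∧ t))
      sides : ∀ j → T ((toℕ j <ᵇ suc a) ∨ avoids F ((c ◂ f) j))
      sides = allᵇ-allFin⇒ (proj₂ (to T-∧ t))
      proper-f : IsProper (bipartite a) f
      proper-f i j = proper (fsuc i) (fsuc j)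
      second-side : ∀ j → T ((toℕ j <ᵇ a) ∨ avoids (c ∷ F) (f j))
      second-side j with toℕ j <ᵇ a in j<a
      ... | true  = _
      ... | false = from T-∧ (≢⇒colour-neqᵇ (≢-sym (proper fzero (fsuc j) (subst (T ∘ not) (sym j<a) _))) ,
                              subst (λ x → T (x ∨ avoids F (f j))) j<a (sides (fsuc j)))

  avoiding-colouring-weaken : ∀ {a c F} f → T (avoiding-colouring a (c ∷ F) f) → T (avoiding-colouring a F f)
  avoiding-colouring-weaken {a} {c} {F} f t =
    from (T-∧ {properᵇ (bipartite a) f})
         (proj₁ parts , ⇒allᵇ-allFin (λ j → T-∨-∧-dropˡ {toℕ j <ᵇ a} (sides j)))
    where
    parts = to (T-∧ {properᵇ (bipartite a) f}) t
    sides : ∀ j → T ((toℕ j <ᵇ a) ∨ avoids (c ∷ F) (f j))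
    sides = allᵇ-allFin⇒ (proj₂ parts)

  q*count-avoiding-colouring≤ : ∀ a (F : List (Fin q)) → Unique F →
    q * count (avoiding-colouring a F) (allMaps (a + b) q) ≤ bipartite-bound a (length F)
  q*count-avoiding-colouring≤ zero F uniq = begin
    q * count (avoiding-colouring 0 F) (allMaps b q)
      ≤⟨ *-monoʳ-≤ q (count-mono (λ g → proj₂ ∘ to (T-∧ {properᵇ (bipartite 0) g})) (allMaps b q)) ⟩
    q * count (λ g → allᵇ (avoids F ∘ g) (allFin b)) (allMaps b q)
      ≤⟨ *-monoʳ-≤ q (count-allMaps-all≤ b (avoids F)) ⟩
    q * count (avoids F) (allFin q) ^ b
      ≤⟨ *-monoʳ-≤ q (^-monoˡ-≤ b (m+n≤o⇒m≤o∸n _ (count-avoids+length≤ F uniq))) ⟩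
    q * (q ∸ length F) ^ b
      ≡⟨ cong (λ z → z * (q ∸ length F) ^ b) (*-identityʳ q) ⟨
    q * 1 * (q ∸ length F) ^ b
      ≡⟨ +-identityʳ _ ⟨
    bipartite-bound 0 (length F) ∎
    where open ≤-Reasoning
  q*count-avoiding-colouring≤ (suc a) F uniq = begin
    q * count (avoiding-colouring (suc a) F) (allMaps (suc a + b) q)
      ≡⟨ cong (q *_) (count-allMaps-suc′ (avoiding-colouring (suc a) F)) ⟩
    q * sum (map (λ c → count (λ f → avoiding-colouring (suc a) F (c ◂ f)) (allMaps (a + b) q)) (allFin q))
      ≤⟨ *-monoʳ-≤ q (sum-map-mono (λ c → count-mono (avoiding-colouring-restrict {F = F} c) (allMaps (a + b) q))
                                   (allFin q)) ⟩
    q * sum (map (λ c → count (avoiding-colouring a (c ∷ F)) (allMaps (a + b) q)) (allFin q))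
      ≡⟨ sum-map-*ˡ q (λ c → count (avoiding-colouring a (c ∷ F)) (allMaps (a + b) q)) (allFin q) ⟨
    sum (map (λ c → q * count (avoiding-colouring a (c ∷ F)) (allMaps (a + b) q)) (allFin q))
      ≤⟨ sum-map≤-split _ (avoids F) _ _ new-colour old-colour (allFin q) ⟩
    count (avoids F) (allFin q) * bipartite-bound a (suc l) + count (not ∘ avoids F) (allFin q) * bipartite-bound a l
      ≤⟨ +-mono-≤ (*-monoˡ-≤ _ (count-allFin≤ q (avoids F))) (*-monoˡ-≤ _ (count-not-avoids≤length F)) ⟩
    q * bipartite-bound a (suc l) + l * bipartite-bound a l
      ≤⟨ bipartite-bound-step a l ⟩
    bipartite-bound (suc a) l ∎
    where
    open ≤-Reasoning
    open Prepend (prepend (a + b) q)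
    l = length F
    new-colour : ∀ c → T (avoids F c) →
      q * count (avoiding-colouring a (c ∷ F)) (allMaps (a + b) q) ≤ bipartite-bound a (suc l)
    new-colour c c-avoids = q*count-avoiding-colouring≤ a (c ∷ F) (All.tabulate (avoids⇒≢ c-avoids) ∷ uniq)
    old-colour : ∀ c → ¬ T (avoids F c) →
      q * count (avoiding-colouring a (c ∷ F)) (allMaps (a + b) q) ≤ bipartite-bound a l
    old-colour c _ = ≤-trans (*-monoʳ-≤ q (count-mono (avoiding-colouring-weaken {a} {c} {F}) (allMaps (a + b) q)))
                             (q*count-avoiding-colouring≤ a F uniq)

  q*hom-Kbip≤ : ∀ a → q * hom (Kbip a b) (K q) ≤ q ^ suc a * (q ∸ a) ^ b + bipartite-error a 0 * q ^ (a + b)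
  q*hom-Kbip≤ a =
    ≤-trans (*-monoʳ-≤ q (count-mono avoiding (allMaps (a + b) q))) (q*count-avoiding-colouring≤ a [] [])
    where
    avoiding : ∀ g → T (properᵇ (adj (Kbip a b)) g) → T (avoiding-colouring a [] g)
    avoiding g t = from T-∧
      ( properᵇ-antitone {E = adj (Kbip a b)} {g = g} (bipartite⇒Kbip-adj a b) t
      , ⇒allᵇ-allFin {n = a + b} {p = λ j → (toℕ j <ᵇ a) ∨ true} (λ j → subst T (sym (∨-zeroʳ (toℕ j <ᵇ a))) _))

module _ (δ : ℕ) where
  private
    d : ℕ
    d = suc δ

  SameBlock StarEdge : ℕ → ℕ → Set
  SameBlock x y = x / d ≡ y / d
  StarEdge x y = x % d ≡ 0 × y % d ≡ 0 × x / d ≢ y / d × (x / d ≡ 0 ⊎ y / d ≡ 0)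

  module _ {k : ℕ} where

    G₁-adj⇒ : ∀ u v → T (adj (G₁ δ k) u v) →
      (toℕ u ≢ toℕ v × SameBlock (toℕ u) (toℕ v)) ⊎ StarEdge (toℕ u) (toℕ v)
    G₁-adj⇒ u v t with to T-∨ t
    ... | inj₁ same = let u≢v , u~v = to T-∧ same in inj₁ (neqᵇ⇒≢ u≢v , ≡ᵇ⇒≡ _ _ u~v)
    ... | inj₂ star =
      let u%d , rest = to T-∧ star ; v%d , rest = to T-∧ rest ; u≁v , centre = to T-∧ rest
      in inj₂ ( ≡ᵇ⇒≡ _ _ u%d , ≡ᵇ⇒≡ _ _ v%d , neqᵇ⇒≢ u≁v
              , Sum.map (≡ᵇ⇒≡ _ _) (≡ᵇ⇒≡ _ _) (to T-∨ centre))

    G₁-loopless : Loopless (adj (G₁ δ k))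
    G₁-loopless u t with G₁-adj⇒ u u t
    ... | inj₁ (u≢u , _)         = u≢u refl
    ... | inj₂ (_ , _ , u≁u , _) = u≁u refl

    G₁-adjacent⇒ : ∀ u v → T (adj (G₁ δ k) u v) ⊎ T (adj (G₁ δ k) v u) →
      SameBlock (toℕ u) (toℕ v) ⊎ StarEdge (toℕ u) (toℕ v)
    G₁-adjacent⇒ u v (inj₁ t) with G₁-adj⇒ u v t
    ... | inj₁ (_ , same) = inj₁ same
    ... | inj₂ star       = inj₂ star
    G₁-adjacent⇒ u v (inj₂ t) with G₁-adj⇒ v u t
    ... | inj₁ (_ , same)                   = inj₁ (sym same)
    ... | inj₂ (v%d , u%d , v≁u , centre) = inj₂ (u%d , v%d , ≢-sym v≁u , Sum.swap centre)

  -- The star centre 0 is followed by its block 1..δ and the other specified vertices (i+1)(δ+1);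
  -- any other vertex is only followed by the rest of its block.
  laterNeighbours : ℕ → ℕ → List ℕ
  laterNeighbours k zero    = map suc (upTo δ) ++ map (λ i → suc i * d) (upTo (k ∸ 1))
  laterNeighbours k (suc u) = map (suc (suc u) +_) (upTo (δ ∸ suc u % d))

  private
    block-bound : ∀ v B → v / d ≡ B → v < d + B * d
    block-bound v B v/d≡B = begin-strict
      v                  ≡⟨ m≡m%n+[m/n]*n v d ⟩
      v % d + v / d * d  ≡⟨ cong (λ z → v % d + z * d) v/d≡B ⟩
      v % d + B * d      <⟨ +-monoˡ-< (B * d) (m%n<n v d) ⟩
      d + B * d          ∎
      where open ≤-Reasoning

  later-neighbour∈ : ∀ k u v → u < v → v < d * k → SameBlock u v ⊎ StarEdge u v → v ∈ laterNeighbours k u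
  later-neighbour∈ k zero (suc w) _ _ (inj₁ same) =
    ∈-++⁺ˡ (∈-map⁺ suc (∈-upTo⁺ (≤-pred (subst (suc w <_) (+-identityʳ d) (block-bound (suc w) 0 (sym same))))))
  later-neighbour∈ k zero v _ v<n (inj₂ (_ , v%d≡0 , 0≁v , _)) =
    ∈-++⁺ʳ (map suc (upTo δ)) (centre-neighbour (v / d) refl)
    where
    centre-neighbour : ∀ B → v / d ≡ B → v ∈ map (λ i → suc i * d) (upTo (k ∸ 1))
    centre-neighbour zero    v/d≡0 = ⊥-elim (0≁v (sym v/d≡0))
    centre-neighbour (suc j) v/d≡B =
      subst (_∈ map (λ i → suc i * d) (upTo (k ∸ 1))) (sym v≡) (∈-map⁺ (λ i → suc i * d) (∈-upTo⁺ j<k∸1))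
      where
      v≡ : v ≡ suc j * d
      v≡ = trans (m≡m%n+[m/n]*n v d) (cong₂ (λ x y → x + y * d) v%d≡0 v/d≡B)
      j<k∸1 : j < k ∸ 1
      j<k∸1 = ∸-monoˡ-≤ 1 (subst (_< k) v/d≡B (m<n*o⇒m/o<n (subst (v <_) (*-comm d k) v<n)))
  later-neighbour∈ k (suc u) v u<v _ (inj₁ same) =
    subst (_∈ map (suc (suc u) +_) (upTo (δ ∸ p))) v≡ (∈-map⁺ (suc (suc u) +_) (∈-upTo⁺ w<δ∸p))
    where
    p blk w : ℕ
    p = suc u % d
    blk = suc u / d
    w = v ∸ suc (suc u)
    v≡ : suc (suc u) + w ≡ v
    v≡ = m+[n∸m]≡n u<v
    p+w<δ : suc (p + w) ≤ δ
    p+w<δ = +-cancelʳ-< (blk * d) (p + w) δ (≤-pred (begin-strict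
      suc (p + w + blk * d)   ≡⟨ cong suc (x+y+z≡x+z+y p w (blk * d)) ⟩
      suc (p + blk * d + w)   ≡⟨ cong (λ z → suc z + w) (m≡m%n+[m/n]*n (suc u) d) ⟨
      suc (suc u) + w       ≡⟨ v≡ ⟩
      v                     <⟨ block-bound v blk (sym same) ⟩
      d + blk * d             ∎))
      where
      open ≤-Reasoning
      x+y+z≡x+z+y : ∀ x y z → x + y + z ≡ x + z + y
      x+y+z≡x+z+y = solve-∀
    w<δ∸p : w < δ ∸ p
    w<δ∸p = subst (_≤ δ ∸ p) (trans (cong (_∸ p) (sym (+-suc p w))) (m+n∸m≡n p (suc w))) (∸-monoˡ-≤ p p+w<δ)
  later-neighbour∈ k (suc u) v u<v _ (inj₂ (u%d≡0 , _ , _ , centre)) =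
    ⊥-elim (u/d≢0 (Sum.[ id , v/d≡0⇒u/d≡0 ] centre))
    where
    u/d≢0 : suc u / d ≢ 0
    u/d≢0 u/d≡0 = 1+n≢0 (trans (m≡m%n+[m/n]*n (suc u) d) (cong₂ (λ x y → x + y * d) u%d≡0 u/d≡0))
    v/d≡0⇒u/d≡0 : v / d ≡ 0 → suc u / d ≡ 0
    v/d≡0⇒u/d≡0 v/d≡0 = n≤0⇒n≡0 (subst (suc u / d ≤_) v/d≡0 (/-monoˡ-≤ d (<⇒≤ u<v)))

  laterDegree-G₁≤ : ∀ k (u : Fin (d * k)) → laterDegree (adj (G₁ δ k)) u ≤ length (laterNeighbours k (toℕ u))
  laterDegree-G₁≤ k u = count-allFin≤length _ (laterNeighbours k (toℕ u)) later
    where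
    later : ∀ v → T ((toℕ u <ᵇ toℕ v) ∧ (adj (G₁ δ k) u v ∨ adj (G₁ δ k) v u)) →
      toℕ v ∈ laterNeighbours k (toℕ u)
    later v t = let u<v , u~v = to T-∧ t in
      later-neighbour∈ k (toℕ u) (toℕ v) (<ᵇ⇒< _ _ u<v) (toℕ<n v) (G₁-adjacent⇒ u v (to T-∨ u~v))

  laterInBlock : ℕ → ℕ
  laterInBlock u = δ ∸ u % d

  length-laterNeighbours-centre : ∀ k → length (laterNeighbours k 0) ≡ δ + (k ∸ 1)
  length-laterNeighbours-centre k = begin
    length (map suc (upTo δ) ++ map (λ i → suc i * d) (upTo (k ∸ 1)))
      ≡⟨ length-++ (map suc (upTo δ)) ⟩
    length (map suc (upTo δ)) + length (map (λ i → suc i * d) (upTo (k ∸ 1)))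
      ≡⟨ cong₂ _+_ (trans (length-map suc (upTo δ)) (length-upTo δ))
                   (trans (length-map (λ i → suc i * d) (upTo (k ∸ 1))) (length-upTo (k ∸ 1))) ⟩
    δ + (k ∸ 1) ∎
    where open ≡-Reasoning

  length-laterNeighbours-suc : ∀ k u → length (laterNeighbours k (suc u)) ≡ laterInBlock (suc u)
  length-laterNeighbours-suc k u = trans (length-map _ (upTo (δ ∸ suc u % d))) (length-upTo _)

  length-laterNeighbours≤ : ∀ k u → length (laterNeighbours k u) ≤ δ + k
  length-laterNeighbours≤ k zero    =
    ≤-trans (≤-reflexive (length-laterNeighbours-centre k)) (+-monoʳ-≤ δ (m∸n≤m k 1))
  length-laterNeighbours≤ k (suc u) =
    ≤-trans (≤-reflexive (length-laterNeighbours-suc k u)) (≤-trans (m∸n≤m δ (suc u % d)) (m≤m+n δ k))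

  ∑<-laterInBlock≤ : ∑< d laterInBlock ≤ δ + δ * (δ ∸ 1)
  ∑<-laterInBlock≤ = +-monoʳ-≤ δ (∑<-≤ δ (laterInBlock ∘ suc) (δ ∸ 1) later-in-block≤)
    where
    later-in-block≤ : ∀ u → u < δ → δ ∸ suc u % d ≤ δ ∸ 1
    later-in-block≤ u u<δ =
      ≤-trans (≤-reflexive (cong (δ ∸_) (m<n⇒m%n≡m (s≤s u<δ)))) (∸-monoʳ-≤ δ (s≤s z≤n))

  -- Every edge inside a block is counted once, giving δ(δ+1)/2 ≤ δ² per block, plus the k - 1 star edges.
  ∑<-length-laterNeighbours≤ : ∀ k′ →
    ∑< (d * suc k′) (length ∘ laterNeighbours (suc k′)) ≤ k′ + suc k′ * (δ + δ * (δ ∸ 1))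
  ∑<-length-laterNeighbours≤ k′ = begin
    ∑< (d * suc k′) (length ∘ laterNeighbours (suc k′))
      ≡⟨ cong₂ _+_ (length-laterNeighbours-centre (suc k′))
                   (∑<-cong (k′ + δ * suc k′) (length-laterNeighbours-suc (suc k′))) ⟩
    δ + k′ + ∑< (k′ + δ * suc k′) (laterInBlock ∘ suc)
      ≡⟨ trans (cong (_+ ∑< (k′ + δ * suc k′) (laterInBlock ∘ suc)) (+-comm δ k′)) (+-assoc k′ δ _) ⟩
    k′ + ∑< (d * suc k′) laterInBlock
      ≡⟨ cong (k′ +_) (∑<-periodic d (suc k′) laterInBlock periodic) ⟩
    k′ + suc k′ * ∑< d laterInBlock
      ≤⟨ +-monoʳ-≤ k′ (*-monoʳ-≤ (suc k′) ∑<-laterInBlock≤) ⟩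
    k′ + suc k′ * (δ + δ * (δ ∸ 1)) ∎
    where
    open ≤-Reasoning
    periodic : ∀ u → laterInBlock (d + u) ≡ laterInBlock u
    periodic u = cong (δ ∸_) (trans (cong (_% d) (+-comm d u)) ([m+n]%n≡m%n u d))

-- Writing k′ = X + t, the two sides differ by 1 + t + e(X + t + 1).
edge-budget : ∀ e R k′ → R + (2 + e) * (2 + e) ≤ k′ →
  R + (k′ + suc k′ * ((2 + e) + (2 + e) * suc e)) + 1 ≤ suc ((3 + e) * k′) * (2 + e)
edge-budget e R k′ R+δ²≤k′ rewrite sym (m+[n∸m]≡n R+δ²≤k′) =
  ≤-trans (m≤m+n _ (1 + t + e * (X + t + 1))) (≤-reflexive (identity e R t))
  where
  X = R + (2 + e) * (2 + e)
  t = k′ ∸ X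
  identity : ∀ e R t →
    let X = R + (2 + e) * (2 + e) in
    R + (X + t + suc (X + t) * ((2 + e) + (2 + e) * suc e)) + 1 + (1 + t + e * (X + t + 1))
      ≡ suc ((3 + e) * (X + t)) * (2 + e)
  identity = solve-∀

module _ (e : ℕ) where
  private
    δ R : ℕ
    δ = 2 + e
    R = bipartite-error δ 0

  module _ (k′ : ℕ) where
    private
      k n b E : ℕ
      k = suc k′
      n = suc δ * k
      b = n ∸ δ
      E = ∑< n (length ∘ laterNeighbours δ k)

      n≡ : n ≡ δ + suc (suc δ * k′)
      n≡ = trans (*-suc (suc δ) k′) (sym (+-suc δ (suc δ * k′)))

      b≡ : b ≡ suc (suc δ * k′)
      b≡ = trans (cong (_∸ δ) n≡) (m+n∸m≡n δ (suc (suc δ * k′)))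

    threshold : ℕ
    threshold = (R + E) * (b * δ) + (δ + k)

    G₁-beats-Kbip : R + δ * δ ≤ k′ → ∀ q → threshold < q → hom (Kbip δ b) (K q) < hom (G₁ δ k) (K q)
    G₁-beats-Kbip R+δ²≤k′ (suc q′) threshold<q =
      count-comparison q δ b R E (hom (G₁ δ k) (K q)) (hom (Kbip δ b) (K q))
        (q*hom-Kbip≤ b δ) lower room (≤-trans (s≤s (m≤m+n _ (δ + k))) threshold<q)
      where
      q = suc q′
      δ+b≡n : δ + b ≡ n
      δ+b≡n = trans (cong (δ +_) b≡) (sym n≡)
      D : ℕ → ℕ
      D = length ∘ laterNeighbours δ k
      D≤q : ∀ u → u < n → D u ≤ q
      D≤q u _ = ≤-trans (length-laterNeighbours≤ δ k u) (≤-trans (m≤n+m (δ + k) _) (<⇒≤ threshold<q))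
      greedy : ∏< n (λ u → q ∸ D u) ≤ hom (G₁ δ k) (K q)
      greedy = greedy-colourings (adj (G₁ δ k)) D (G₁-loopless δ {k}) (laterDegree-G₁≤ δ k)
      lower : q ^ suc (δ + b) ≤ q * hom (G₁ δ k) (K q) + E * q ^ (δ + b)
      lower = subst (λ m → q ^ suc m ≤ q * hom (G₁ δ k) (K q) + E * q ^ m) (sym δ+b≡n)
                (≤-trans (weierstrass-product q n D D≤q) (+-monoˡ-≤ (E * q ^ n) (*-monoʳ-≤ q greedy)))
      room : R + E + 1 ≤ b * δ
      room = ≤-trans (+-monoˡ-≤ 1 (+-monoʳ-≤ R (∑<-length-laterNeighbours≤ δ k′)))
                     (subst (λ z → R + (k′ + suc k′ * (δ + δ * (δ ∸ 1))) + 1 ≤ z * δ) (sym b≡)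
                            (edge-budget e R k′ R+δ²≤k′))

theorem2 : (δ : ℕ) → 2 ≤ δ →
    ∃ λ N → (k : ℕ) → N ≤ suc δ * k →
      ∃ λ Q → (q : ℕ) → Q ≤ q →
        hom (Kbip δ (suc δ * k ∸ δ)) (K q) < hom (G₁ δ k) (K q)
theorem2 1                (s≤s ())
theorem2 δ@(suc (suc e)) _ = suc δ * suc (bipartite-error δ 0 + δ * δ) , large-k
  where
  large-k : (k : ℕ) → suc δ * suc (bipartite-error δ 0 + δ * δ) ≤ suc δ * k →
    ∃ λ Q → (q : ℕ) → Q ≤ q → hom (Kbip δ (suc δ * k ∸ δ)) (K q) < hom (G₁ δ k) (K q)
  large-k zero    N≤0 with () ← ≤-trans N≤0 (≤-reflexive (*-zeroʳ (suc δ)))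
  large-k (suc k′) N≤n = suc (threshold e k′) , G₁-beats-Kbip e k′ (s≤s⁻¹ (*-cancelˡ-≤ (suc δ) N≤n))
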